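{- Let $v=x_0^{\alpha_0}x_1^{\alpha_1}\cdots x_n^{\alpha_n}$ with $x_i\in\{a,b\}$, $\alpha_i\ge1$, $x_{i+1}\ne x_i$. Then \[|a\psi(v)b|=\sum_{i=0}^{n-1}\alpha_i\,\bigl|a\psi(x_{i+1}^{\alpha_{i+1}-1}x_{i+2}^{\alpha_{i+2}}\cdots x_n^{\alpha_n})b\bigr|+\alpha_n+2.\]
   Context: Palindromization map on $\{a,b\}^*$: $\psi(\varepsilon)=\varepsilon$ and $\psi(ux)=(\psi(u)x)^{(+)}$ for a word $u$ and letter $x$, where $z^{(+)}$ is the shortest palindrome having $z$ as prefix. -}

module Defs where

open import Data.Nat using (ℕ; zero; suc; _+_; _*_; _∸_)
open import Data.List using (List; []; _∷_; _++_; reverse; take; length; replicate; concatMap; drop; upTo)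
open import Data.List.Properties using (≡-dec)
open import Relation.Binary.PropositionalEquality using (_≡_; refl)
open import Relation.Nullary using (Dec; yes; no)

data Letter : Set where
  a b : Letter

_≟L_ : (x y : Letter) → Dec (x ≡ y)
a ≟L a = yes refl
a ≟L b = no (λ ())
b ≟L a = no (λ ())
b ≟L b = yes refl

Word : Set
Word = List Letter

IsPalindrome : Word → Set
IsPalindrome w = reverse w ≡ w

isPalindrome? : (w : Word) → Dec (IsPalindrome w)
isPalindrome? w = ≡-dec _≟L_ (reverse w) w

-- Any palindrome having z as prefix, of length |z| + k with k ≤ |z|,
-- is  z ++ reverse (take k z).  Search k = 0, 1, ..., |z| for the first
-- such candidate that is a palindrome (k = |z| always works), giving the
-- shortest palindrome having z as prefix.
private
  search : ℕ → ℕ → Word → Word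
  search k zero    z = z ++ reverse z
  search k (suc f) z with isPalindrome? (z ++ reverse (take k z))
  ... | yes _ = z ++ reverse (take k z)
  ... | no  _ = search (suc k) f z

palClosure : Word → Word
palClosure z = search 0 (length z) z

ψ-acc : Word → Word → Word
ψ-acc acc []      = acc
ψ-acc acc (x ∷ u) = ψ-acc (palClosure (acc ++ x ∷ [])) u

ψ : Word → Word
ψ = ψ-acc []

-- the word  x_j^{α_j} x_{j+1}^{α_{j+1}} ⋯ x_n^{α_n}  (empty if j > n)
blocksFrom : (x : ℕ → Letter) (α : ℕ → ℕ) (n j : ℕ) → Word
blocksFrom x α n j = concatMap (λ k → replicate (α k) (x k)) (drop j (upTo (suc n)))

{-# OPTIONS --safe #-}
module Submission where

-- Let x̄ be the letter other than x, and μₓ the morphism fixing x and sending x̄ to x x̄.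
-- Justin's formula ψ(x u) = μₓ(ψ u) x shows that ψ(x u) contains |ψ u| + 1 letters x and
-- as many letters x̄ as ψ u.  Iterating, |ψ(xᵏ x̄ w)| = |ψ(x̄ w)| + k (|ψ w| + 2), that is,
-- |aψ(xᵏ x̄ w)b| = k |aψ(w)b| + |aψ(x̄ w)b|.  Peeling off the blocks of v one at a time, this
-- telescopes into the stated sum, the last block contributing |aψ(xₙ^αₙ)b| = αₙ + 2.
--
-- Justin's formula is proved by induction on u from the right, from two recurrences for ψ:
-- ψ(u y) = ψ(u) y ψ(u) if y does not occur in u, and ψ(u y) = ψ(u) y t if u = u₁ y u₂ with y
-- not in u₂ and ψ(u) = ψ(u₁) y t.  Both follow from z⁽⁺⁾ = z s̃, where z = s m with m the
-- longest palindromic suffix of z and s̃ the reversal of s, together with the fact that every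
-- palindromic prefix of ψ(u) is ψ(u′) for some prefix u′ of u.

open import Defs
open import Data.Nat using (ℕ; zero; suc; _+_; _*_; _∸_; _⊓_; _≤_; _<_; z≤n; s≤s; z<s; s<s)
open import Data.Nat.Properties
open import Data.Nat.Tactic.RingSolver using (solve-∀)
open import Data.List
  using (List; []; _∷_; _++_; _∷ʳ_; length; reverse; take; drop; concatMap; filter; replicate; applyUpTo; upTo; map)
open import Data.List.Membership.Propositional using (_∈_; _∉_)
open import Data.List.Membership.Propositional.Properties using (∈-insert)
open import Data.List.Relation.Unary.Any using (here; there)
open import Data.List.Properties
open import Data.Product using (Σ; ∃; ∃₂; _×_; _,_; proj₁; proj₂)
open import Relation.Nullary using (yes; no; contradiction)
open import Data.Sum using (_⊎_; inj₁; inj₂)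
open import Relation.Binary.PropositionalEquality
open import Function using (_∘_; id)
open import Data.Nat.ListAction using (sum)
open import Data.List.Reverse using (reverseView; []; _∶_∶ʳ_)
open import Induction.WellFounded using (Acc; acc)
open import Data.Nat.Induction using (<-wellFounded)

-- Lists and prefixes

take-length-++ : ∀ {A : Set} (xs ys : List A) → take (length xs) (xs ++ ys) ≡ xs
take-length-++ []       ys = refl
take-length-++ (x ∷ xs) ys = cong (x ∷_) (take-length-++ xs ys)

drop-length-++ : ∀ {A : Set} (xs ys : List A) → drop (length xs) (xs ++ ys) ≡ ys
drop-length-++ []       ys = refl
drop-length-++ (x ∷ xs) ys = drop-length-++ xs ys

++-injective : ∀ {A : Set} (xs ys us vs : List A) → length xs ≡ length us →
               xs ++ ys ≡ us ++ vs → xs ≡ us × ys ≡ vs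
++-injective xs ys us vs |xs|≡|us| eq =
  trans (sym (take-length-++ xs ys)) (trans (cong₂ take |xs|≡|us| eq) (take-length-++ us vs)) ,
  trans (sym (drop-length-++ xs ys)) (trans (cong₂ drop |xs|≡|us| eq) (drop-length-++ us vs))

drop-++ˡ : ∀ {A : Set} j (xs ys : List A) → j ≤ length xs → drop j (xs ++ ys) ≡ drop j xs ++ ys
drop-++ˡ zero    xs       ys _         = refl
drop-++ˡ (suc j) (x ∷ xs) ys (s≤s j≤n) = drop-++ˡ j xs ys j≤n

length-<-++-∷ : ∀ {A : Set} (xs : List A) y ys → length xs < length (xs ++ y ∷ ys)
length-<-++-∷ xs y ys = ≤-trans (s≤s (length-++-≤ˡ xs)) (≤-reflexive (sym (length-++-sucʳ xs y ys)))

infix 4 _⊑_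
_⊑_ : {A : Set} → List A → List A → Set
p ⊑ w = ∃ λ t → w ≡ p ++ t

⊑-length : ∀ {A : Set} {p w : List A} → p ⊑ w → length p ≤ length w
⊑-length {p = p} (t , refl) = length-++-≤ˡ p

⊑-longest : ∀ {A : Set} {p w : List A} → p ⊑ w → length w ≤ length p → p ≡ w
⊑-longest {p = p} ([]    , refl) _   = sym (++-identityʳ p)
⊑-longest {p = p} (c ∷ t , refl) |w|≤|p| =
  contradiction (≤-trans (≤-reflexive (sym (length-++ p))) |w|≤|p|) (m+1+n≰m (length p))

⊑-++-∷ : ∀ {A : Set} (p q : List A) {x r} → p ⊑ q ++ x ∷ r → p ⊑ q ⊎ q ∷ʳ x ⊑ p
⊑-++-∷ []      q       _ = inj₁ (q , refl)
⊑-++-∷ (c ∷ p) []      (t , eq) = inj₂ (p , cong (_∷ p) (sym (∷-injectiveˡ eq)))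
⊑-++-∷ (c ∷ p) (d ∷ q) (t , eq) with ∷-injective eq
... | refl , eq′ with ⊑-++-∷ p q (t , eq′)
...   | inj₁ (e , q≡pe) = inj₁ (e , cong (d ∷_) q≡pe)
...   | inj₂ (e , p≡qxe) = inj₂ (e , cong (d ∷_) p≡qxe)

-- Palindromic closure

reverse-wrap : ∀ (s m : Word) → reverse (s ++ m ++ reverse s) ≡ s ++ reverse m ++ reverse s
reverse-wrap s m = begin
  reverse (s ++ m ++ reverse s)             ≡⟨ reverse-++ s (m ++ reverse s) ⟩
  reverse (m ++ reverse s) ++ reverse s     ≡⟨ cong (_++ reverse s) (reverse-++ m (reverse s)) ⟩
  (reverse (reverse s) ++ reverse m) ++ reverse s
    ≡⟨ cong (λ s′ → (s′ ++ reverse m) ++ reverse s) (reverse-involutive s) ⟩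
  (s ++ reverse m) ++ reverse s             ≡⟨ ++-assoc s (reverse m) (reverse s) ⟩
  s ++ reverse m ++ reverse s               ∎
  where open ≡-Reasoning

wrap-palindrome : ∀ s {m} → IsPalindrome m → IsPalindrome (s ++ m ++ reverse s)
wrap-palindrome s {m} pal = trans (reverse-wrap s m) (cong (λ m′ → s ++ m′ ++ reverse s) pal)

unwrap-palindrome : ∀ s {m} → IsPalindrome (s ++ m ++ reverse s) → IsPalindrome m
unwrap-palindrome s {m} pal =
  ++-cancelʳ (reverse s) (reverse m) m (++-cancelˡ s _ _ (trans (sym (reverse-wrap s m)) pal))

palindrome-∷-∷ʳ : ∀ c p y → IsPalindrome (c ∷ p ++ y ∷ []) → c ≡ y × IsPalindrome p
palindrome-∷-∷ʳ c p y pal with ∷-injectiveˡ (trans (sym (reverse-++ (c ∷ p) (y ∷ []))) pal)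
... | refl = refl , unwrap-palindrome (y ∷ []) pal

record LongestPalSuffix (z : Word) (k : ℕ) : Set where
  field
    palindromic : IsPalindrome (drop k z)
    longest     : ∀ j → IsPalindrome (drop j z) → k ≤ j

closeAt : ℕ → Word → Word
closeAt k z = z ++ reverse (take k z)

closeAt-wrap : ∀ k z → closeAt k z ≡ take k z ++ drop k z ++ reverse (take k z)
closeAt-wrap k z = trans (cong (_++ reverse (take k z)) (sym (take++drop≡id k z)))
                         (++-assoc (take k z) (drop k z) (reverse (take k z)))

IsPalClosure : Word → Word → Set
IsPalClosure z r = Σ ℕ λ k → LongestPalSuffix z k × r ≡ closeAt k z

closeAt-palindrome : ∀ k z → IsPalindrome (drop k z) → IsPalindrome (closeAt k z)
closeAt-palindrome k z pal =
  subst IsPalindrome (sym (closeAt-wrap k z)) (wrap-palindrome (take k z) pal)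

closeAt-palindrome⁻¹ : ∀ k z → IsPalindrome (closeAt k z) → IsPalindrome (drop k z)
closeAt-palindrome⁻¹ k z pal = unwrap-palindrome (take k z) (subst IsPalindrome (closeAt-wrap k z) pal)

record SearchInvariant (z : Word) (k f : ℕ) : Set where
  field
    fuel    : k + f ≡ length z
    shorter : ∀ j → IsPalindrome (drop j z) → k ≤ j

-- palClosure z reduces to search 0 (length z) z, where search is private to Defs and cannot be
-- named.  Abstracting both arguments exposes that call, so the result word of search-spec can
-- be left to unification (the underscore), which solves it as search k f z.  SearchInvariant is
-- a record so that this abstraction does not reach inside its fields.
mutual
  search-spec-start : ∀ z → SearchInvariant z 0 (length z) → IsPalClosure z (palClosure z)
  search-spec-start z with 0 | length z
  ... | k | f = search-spec z k f

  search-spec : ∀ z k f → SearchInvariant z k f → IsPalClosure z _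
  search-spec z k zero inv =
    k , record { palindromic = subst IsPalindrome (sym (drop-all k z k≥|z|)) refl ; longest = shorter } ,
    cong (λ w → z ++ reverse w) (sym (take-all k z k≥|z|))
    where
    open SearchInvariant inv
    k≥|z| : length z ≤ k
    k≥|z| = ≤-reflexive (trans (sym fuel) (+-identityʳ k))
  search-spec z k (suc f) inv with isPalindrome? (closeAt k z)
  ... | yes pal = k , record { palindromic = closeAt-palindrome⁻¹ k z pal ; longest = shorter } , refl
    where open SearchInvariant inv
  ... | no ¬pal = search-spec z (suc k) f record { fuel = trans (sym (+-suc k f)) fuel ; shorter = shorter′ }
    where
    open SearchInvariant inv
    shorter′ : ∀ j → IsPalindrome (drop j z) → suc k ≤ j
    shorter′ j pal with m≤n⇒m<n∨m≡n (shorter j pal)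
    ... | inj₁ k<j  = k<j
    ... | inj₂ refl = contradiction (closeAt-palindrome k z pal) ¬pal

palClosure-isPalClosure : ∀ z → IsPalClosure z (palClosure z)
palClosure-isPalClosure z = search-spec-start z record { fuel = refl ; shorter = λ _ _ → z≤n }

palClosure-split : ∀ {z} s {m} → z ≡ s ++ m → LongestPalSuffix z (length s) →
                   palClosure z ≡ z ++ reverse s
palClosure-split {z} s {m} z≡sm lps with palClosure-isPalClosure z
... | k , lpsₖ , eq = trans eq (cong (λ w → z ++ reverse w) take≡s)
  where
  open LongestPalSuffix
  k≡|s| : k ≡ length s
  k≡|s| = ≤-antisym (longest lpsₖ (length s) (palindromic lps)) (longest lps k (palindromic lpsₖ))
  take≡s : take k z ≡ s
  take≡s = trans (cong₂ take k≡|s| z≡sm) (take-length-++ s m)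

palClosure-palindrome : ∀ z → IsPalindrome (palClosure z)
palClosure-palindrome z with palClosure-isPalClosure z
... | k , lps , eq = subst IsPalindrome (sym eq) (closeAt-palindrome k z (LongestPalSuffix.palindromic lps))

palClosure-extends : ∀ z → z ⊑ palClosure z
palClosure-extends z with palClosure-isPalClosure z
... | k , _ , eq = reverse (take k z) , eq

palindrome-++⇒drop : ∀ z r → IsPalindrome (z ++ r) → IsPalindrome (drop (length r) z)
palindrome-++⇒drop z r pal with ≤-total (length z) (length r)
... | inj₁ |z|≤|r| = subst IsPalindrome (sym (drop-all (length r) z |z|≤|r|)) refl
... | inj₂ |r|≤|z| = ++-cancelʳ r (reverse m) m (trans (cong (reverse m ++_) (sym rev-s≡r)) (proj₂ halves))
  where
  s = take (length r) z
  m = drop (length r) z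
  |rev-r|≡|s| : length (reverse r) ≡ length s
  |rev-r|≡|s| = trans (length-reverse r) (sym (trans (length-take (length r) z) (m≤n⇒m⊓n≡m |r|≤|z|)))
  z≡sm : z ≡ s ++ m
  z≡sm = sym (take++drop≡id (length r) z)
  open ≡-Reasoning
  mirrored : reverse r ++ reverse m ++ reverse s ≡ s ++ m ++ r
  mirrored = begin
    reverse r ++ reverse m ++ reverse s     ≡⟨ cong (reverse r ++_) (sym (reverse-++ s m)) ⟩
    reverse r ++ reverse (s ++ m)           ≡⟨ sym (reverse-++ (s ++ m) r) ⟩
    reverse ((s ++ m) ++ r)                 ≡⟨ cong (λ w → reverse (w ++ r)) (sym z≡sm) ⟩
    reverse (z ++ r)                        ≡⟨ pal ⟩
    z ++ r                                  ≡⟨ cong (_++ r) z≡sm ⟩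
    (s ++ m) ++ r                           ≡⟨ ++-assoc s m r ⟩
    s ++ m ++ r                             ∎
  halves = ++-injective (reverse r) _ s _ |rev-r|≡|s| mirrored
  rev-s≡r : reverse s ≡ r
  rev-s≡r = trans (cong reverse (sym (proj₁ halves))) (reverse-involutive r)

palClosure-shortest : ∀ z r → IsPalindrome (z ++ r) → length (palClosure z) ≤ length (z ++ r)
palClosure-shortest z r pal with palClosure-isPalClosure z
... | k , lps , eq = begin
  length (palClosure z)                ≡⟨ cong length eq ⟩
  length (z ++ reverse (take k z))     ≡⟨ length-++ z ⟩
  length z + length (reverse (take k z)) ≡⟨ cong (length z +_) (length-reverse (take k z)) ⟩
  length z + length (take k z)         ≤⟨ +-monoʳ-≤ (length z) |take|≤|r| ⟩
  length z + length r                  ≡⟨ length-++ z ⟨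
  length (z ++ r)                      ∎
  where
  open ≤-Reasoning
  |take|≤|r| : length (take k z) ≤ length r
  |take|≤|r| = ≤-trans (≤-reflexive (length-take k z))
                 (≤-trans (m⊓n≤m k (length z))
                   (LongestPalSuffix.longest lps (length r) (palindrome-++⇒drop z r pal)))

-- The palindromization map ψ

ψ-acc-++ : ∀ z u v → ψ-acc z (u ++ v) ≡ ψ-acc (ψ-acc z u) v
ψ-acc-++ z []      v = refl
ψ-acc-++ z (x ∷ u) v = ψ-acc-++ (palClosure (z ∷ʳ x)) u v

ψ-∷ʳ : ∀ u y → ψ (u ∷ʳ y) ≡ palClosure (ψ u ∷ʳ y)
ψ-∷ʳ u y = ψ-acc-++ [] u (y ∷ [])

ψ-acc-palindrome : ∀ {z} u → IsPalindrome z → IsPalindrome (ψ-acc z u)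
ψ-acc-palindrome []      pal = pal
ψ-acc-palindrome {z} (x ∷ u) _ = ψ-acc-palindrome u (palClosure-palindrome (z ∷ʳ x))

ψ-palindrome : ∀ u → IsPalindrome (ψ u)
ψ-palindrome u = ψ-acc-palindrome u refl

ψ-acc-extends : ∀ z u → z ⊑ ψ-acc z u
ψ-acc-extends z []      = [] , sym (++-identityʳ z)
ψ-acc-extends z (x ∷ u) with ψ-acc-extends (palClosure (z ∷ʳ x)) u | palClosure-extends (z ∷ʳ x)
... | t , eq | r , eq′ = x ∷ r ++ t , (begin
  ψ-acc (palClosure (z ∷ʳ x)) u      ≡⟨ eq ⟩
  palClosure (z ∷ʳ x) ++ t           ≡⟨ cong (_++ t) eq′ ⟩
  ((z ∷ʳ x) ++ r) ++ t               ≡⟨ ++-assoc (z ∷ʳ x) r t ⟩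
  (z ∷ʳ x) ++ r ++ t                 ≡⟨ ++-assoc z (x ∷ []) (r ++ t) ⟩
  z ++ x ∷ r ++ t                    ∎)
  where open ≡-Reasoning

ψ-monotone : ∀ u v → ψ u ⊑ ψ (u ++ v)
ψ-monotone u v with ψ-acc-extends (ψ u) v
... | t , eq = t , trans (ψ-acc-++ [] u v) eq

ψ-++-∷ : ∀ u y v → ∃ λ t → ψ (u ++ y ∷ v) ≡ ψ u ++ y ∷ t
ψ-++-∷ u y v with ψ-monotone (u ∷ʳ y) v | palClosure-extends (ψ u ∷ʳ y)
... | t , eq | r , eq′ = r ++ t , (begin
  ψ (u ++ y ∷ v)               ≡⟨ cong ψ (sym (++-assoc u (y ∷ []) v)) ⟩
  ψ ((u ∷ʳ y) ++ v)            ≡⟨ eq ⟩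
  ψ (u ∷ʳ y) ++ t              ≡⟨ cong (_++ t) (trans (ψ-∷ʳ u y) eq′) ⟩
  ((ψ u ∷ʳ y) ++ r) ++ t       ≡⟨ ++-assoc (ψ u ∷ʳ y) r t ⟩
  (ψ u ∷ʳ y) ++ r ++ t         ≡⟨ ++-assoc (ψ u) (y ∷ []) (r ++ t) ⟩
  ψ u ++ y ∷ r ++ t            ∎)
  where open ≡-Reasoning

ψ-acc-palindromic-prefix : ∀ z u {p} → IsPalindrome p → p ⊑ ψ-acc z u →
                           p ⊑ z ⊎ ∃ λ u′ → u′ ⊑ u × p ≡ ψ-acc z u′
ψ-acc-palindromic-prefix z []      _   p⊑ = inj₁ p⊑
ψ-acc-palindromic-prefix z (x ∷ u) {p} pal p⊑ with ψ-acc-palindromic-prefix (palClosure (z ∷ʳ x)) u pal p⊑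
... | inj₂ (u′ , (v , u≡u′v) , p≡) = inj₂ (x ∷ u′ , (v , cong (x ∷_) u≡u′v) , p≡)
... | inj₁ (e , closure≡pe) with palClosure-extends (z ∷ʳ x)
...   | r , closure≡ with ⊑-++-∷ p z (e , trans (sym (trans closure≡ (++-assoc z (x ∷ []) r))) closure≡pe)
...     | inj₁ p⊑z = inj₁ p⊑z
...     | inj₂ (e′ , refl) = inj₂ (x ∷ [] , (u , refl) , ⊑-longest (e , closure≡pe) shortest)
  where
  shortest : length (palClosure (z ∷ʳ x)) ≤ length ((z ∷ʳ x) ++ e′)
  shortest = palClosure-shortest (z ∷ʳ x) e′ pal

ψ-palindromic-prefix : ∀ u {p} → IsPalindrome p → p ⊑ ψ u → ∃ λ u′ → u′ ⊑ u × p ≡ ψ u′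
ψ-palindromic-prefix u pal p⊑ with ψ-acc-palindromic-prefix [] u pal p⊑
... | inj₂ found         = found
... | inj₁ (e , []≡pe)   = [] , (u , refl) , ++-conicalˡ _ e (sym []≡pe)

ψ-palindromic-prefix-∷ : ∀ u {p y t} → IsPalindrome p → ψ u ≡ p ++ y ∷ t →
                         ∃₂ λ u′ u″ → u ≡ u′ ++ y ∷ u″ × p ≡ ψ u′
ψ-palindromic-prefix-∷ u {y = y} {t} pal eq with ψ-palindromic-prefix u pal (y ∷ t , eq)
... | u′ , ([] , refl) , refl =
  contradiction (trans (sym (length-++ (ψ u′))) (cong length (trans (sym eq) (cong ψ (++-identityʳ u′)))))
                (m+1+n≢m (length (ψ u′)))
... | u′ , (c ∷ v , refl) , refl with ψ-++-∷ u′ c v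
...   | t′ , eq′ = u′ , v , cong (λ d → u′ ++ d ∷ v) c≡y , refl
  where
  c≡y : c ≡ y
  c≡y = ∷-injectiveˡ (++-cancelˡ (ψ u′) _ _ (trans (sym eq′) eq))

palindromic-suffix-∷ʳ : ∀ {w} j y → IsPalindrome w → j < length w → IsPalindrome (drop j (w ∷ʳ y)) →
                        ∃₂ λ p t → IsPalindrome p × w ≡ p ++ y ∷ t × j + suc (length p) ≡ length w
palindromic-suffix-∷ʳ {w} j y palw j<|w| pal with drop j w in eq
... | [] = contradiction (trans (sym (length-drop j w)) (cong length eq)) (m>n⇒m∸n≢0 j<|w|)
... | c ∷ p with palindrome-∷-∷ʳ c p y
                   (subst IsPalindrome (trans (drop-++ˡ j w (y ∷ []) (<⇒≤ j<|w|)) (cong (_++ y ∷ []) eq)) pal)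
...   | refl , palp = p , reverse s , palp , w≡ , |w|≡
  where
  s = take j w
  w≡syp : w ≡ s ++ y ∷ p
  w≡syp = trans (sym (take++drop≡id j w)) (cong (s ++_) eq)
  open ≡-Reasoning
  w≡ : w ≡ p ++ y ∷ reverse s
  w≡ = begin
    w                              ≡⟨ palw ⟨
    reverse w                      ≡⟨ cong reverse w≡syp ⟩
    reverse (s ++ y ∷ p)           ≡⟨ reverse-++ s (y ∷ p) ⟩
    reverse (y ∷ p) ++ reverse s   ≡⟨ cong (_++ reverse s) (unfold-reverse y p) ⟩
    (reverse p ∷ʳ y) ++ reverse s  ≡⟨ ++-assoc (reverse p) (y ∷ []) (reverse s) ⟩
    reverse p ++ y ∷ reverse s     ≡⟨ cong (_++ y ∷ reverse s) palp ⟩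
    p ++ y ∷ reverse s             ∎
  |w|≡ : j + suc (length p) ≡ length w
  |w|≡ = begin
    j + suc (length p)             ≡⟨ cong (_+ suc (length p)) (m≤n⇒m⊓n≡m (<⇒≤ j<|w|)) ⟨
    j ⊓ length w + suc (length p)  ≡⟨ cong (_+ suc (length p)) (length-take j w) ⟨
    length s + length (y ∷ p)      ≡⟨ length-++ s ⟨
    length (s ++ y ∷ p)            ≡⟨ cong length w≡syp ⟨
    length w                       ∎

ψ-palindromic-suffix : ∀ u y j → j < length (ψ u) → IsPalindrome (drop j (ψ u ∷ʳ y)) →
                       ∃₂ λ u′ u″ → u ≡ u′ ++ y ∷ u″ × j + suc (length (ψ u′)) ≡ length (ψ u)
ψ-palindromic-suffix u y j j<|ψu| pal with palindromic-suffix-∷ʳ j y (ψ-palindrome u) j<|ψu| pal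
... | p , t , palp , ψu≡ , |ψu|≡ with ψ-palindromic-prefix-∷ u palp ψu≡
...   | u′ , u″ , u≡ , refl = u′ , u″ , u≡ , |ψu|≡

longestPalSuffix-∷ʳ : ∀ {w} y k → k ≤ length w → IsPalindrome (drop k (w ∷ʳ y)) →
                      (∀ j → j < length w → IsPalindrome (drop j (w ∷ʳ y)) → k ≤ j) →
                      LongestPalSuffix (w ∷ʳ y) k
longestPalSuffix-∷ʳ {w} y k k≤|w| pal below = record { palindromic = pal ; longest = longest }
  where
  longest : ∀ j → IsPalindrome (drop j (w ∷ʳ y)) → k ≤ j
  longest j palj with <-≤-connex j (length w)
  ... | inj₁ j<|w| = below j j<|w| palj
  ... | inj₂ |w|≤j = ≤-trans k≤|w| |w|≤j

ψ-∷ʳ-fresh : ∀ u y → y ∉ u → ψ (u ∷ʳ y) ≡ ψ u ++ y ∷ ψ u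
ψ-∷ʳ-fresh u y y∉u = begin
  ψ (u ∷ʳ y)                      ≡⟨ ψ-∷ʳ u y ⟩
  palClosure (ψ u ∷ʳ y)           ≡⟨ palClosure-split (ψ u) refl lps ⟩
  (ψ u ∷ʳ y) ++ reverse (ψ u)     ≡⟨ ++-assoc (ψ u) (y ∷ []) (reverse (ψ u)) ⟩
  ψ u ++ y ∷ reverse (ψ u)        ≡⟨ cong (λ v → ψ u ++ y ∷ v) (ψ-palindrome u) ⟩
  ψ u ++ y ∷ ψ u                  ∎
  where
  open ≡-Reasoning
  below : ∀ j → j < length (ψ u) → IsPalindrome (drop j (ψ u ∷ʳ y)) → length (ψ u) ≤ j
  below j j<|ψu| pal with ψ-palindromic-suffix u y j j<|ψu| pal
  ... | u′ , u″ , u≡ , _ = contradiction (subst (y ∈_) (sym u≡) (∈-insert u′)) y∉u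
  lps : LongestPalSuffix (ψ u ∷ʳ y) (length (ψ u))
  lps = longestPalSuffix-∷ʳ y (length (ψ u)) ≤-refl
          (subst IsPalindrome (sym (drop-length-++ (ψ u) (y ∷ []))) refl)
          below

data LastOccurrence (y : Letter) : Word → Set where
  absent : ∀ {u} → y ∉ u → LastOccurrence y u
  last   : ∀ u₁ {u₂} → y ∉ u₂ → LastOccurrence y (u₁ ++ y ∷ u₂)

lastOccurrence : ∀ y u → LastOccurrence y u
lastOccurrence y []      = absent λ ()
lastOccurrence y (c ∷ u) with lastOccurrence y u
... | last u₁ y∉u₂ = last (c ∷ u₁) y∉u₂
... | absent y∉u with c ≟L y
...   | yes refl = last [] y∉u
...   | no c≢y   = absent λ where
        (here y≡c)   → c≢y (sym y≡c)
        (there y∈u)  → y∉u y∈u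

occurrence-before-last : ∀ {y} (u₁ : Word) {u₂} u′ {u″} → y ∉ u₂ →
                         u₁ ++ y ∷ u₂ ≡ u′ ++ y ∷ u″ → u′ ⊑ u₁
occurrence-before-last u₁       []       _   _  = u₁ , refl
occurrence-before-last []       (c ∷ u′) y∉u₂ eq =
  contradiction (subst (_ ∈_) (sym (∷-injectiveʳ eq)) (∈-insert u′)) y∉u₂
occurrence-before-last (d ∷ u₁) (c ∷ u′) y∉u₂ eq with ∷-injective eq
... | refl , eq′ with occurrence-before-last u₁ u′ y∉u₂ eq′
...   | e , u₁≡ = e , cong (d ∷_) u₁≡

ψ-∷ʳ-repeat : ∀ u₁ y u₂ {t : Word} → y ∉ u₂ → ψ (u₁ ++ y ∷ u₂) ≡ ψ u₁ ++ y ∷ t →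
              ψ ((u₁ ++ y ∷ u₂) ∷ʳ y) ≡ ψ (u₁ ++ y ∷ u₂) ++ y ∷ t
ψ-∷ʳ-repeat u₁ y u₂ {t} y∉u₂ ψu≡ = begin
  ψ (u ∷ʳ y)                           ≡⟨ ψ-∷ʳ u y ⟩
  palClosure (w ∷ʳ y)                  ≡⟨ palClosure-split (reverse t) wy≡ lps ⟩
  (w ∷ʳ y) ++ reverse (reverse t)      ≡⟨ cong ((w ∷ʳ y) ++_) (reverse-involutive t) ⟩
  (w ∷ʳ y) ++ t                        ≡⟨ ++-assoc w (y ∷ []) t ⟩
  w ++ y ∷ t                           ∎
  where
  open ≡-Reasoning
  u = u₁ ++ y ∷ u₂
  w = ψ u
  w≡ : w ≡ reverse t ++ y ∷ ψ u₁
  w≡ = begin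
    w                                  ≡⟨ ψ-palindrome u ⟨
    reverse w                          ≡⟨ cong reverse ψu≡ ⟩
    reverse (ψ u₁ ++ y ∷ t)            ≡⟨ reverse-++ (ψ u₁) (y ∷ t) ⟩
    reverse (y ∷ t) ++ reverse (ψ u₁)  ≡⟨ cong₂ _++_ (unfold-reverse y t) (ψ-palindrome u₁) ⟩
    (reverse t ∷ʳ y) ++ ψ u₁           ≡⟨ ++-assoc (reverse t) (y ∷ []) (ψ u₁) ⟩
    reverse t ++ y ∷ ψ u₁              ∎
  wy≡ : w ∷ʳ y ≡ reverse t ++ (y ∷ ψ u₁ ∷ʳ y)
  wy≡ = trans (cong (_∷ʳ y) w≡) (++-assoc (reverse t) (y ∷ ψ u₁) (y ∷ []))
  |w|≡ : length w ≡ length (reverse t) + suc (length (ψ u₁))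
  |w|≡ = trans (cong length w≡) (length-++ (reverse t))
  below : ∀ j → j < length w → IsPalindrome (drop j (w ∷ʳ y)) → length (reverse t) ≤ j
  below j j<|w| pal with ψ-palindromic-suffix u y j j<|w| pal
  ... | u′ , u″ , u≡ , |w|≡′ with occurrence-before-last u₁ u′ y∉u₂ u≡
  ...   | e , refl = +-cancelʳ-≤ (suc (length (ψ u₁))) (length (reverse t)) j
    (subst (_≤ j + suc (length (ψ u₁))) (trans |w|≡′ |w|≡)
           (+-monoʳ-≤ j (s≤s (⊑-length (ψ-monotone u′ e)))))
  lps : LongestPalSuffix (w ∷ʳ y) (length (reverse t))
  lps = longestPalSuffix-∷ʳ y (length (reverse t))
          (subst (λ v → length (reverse t) ≤ length v) (sym w≡) (length-++-≤ˡ (reverse t)))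
          (subst IsPalindrome (sym (trans (cong (drop (length (reverse t))) wy≡) (drop-length-++ (reverse t) _)))
                 (wrap-palindrome (y ∷ []) (ψ-palindrome u₁)))
          below

-- Justin's formula

other : Letter → Letter
other a = b
other b = a

≢⇒other : ∀ {x y} → y ≢ x → y ≡ other x
≢⇒other {a} {a} y≢x = contradiction refl y≢x
≢⇒other {a} {b} _   = refl
≢⇒other {b} {a} _   = refl
≢⇒other {b} {b} y≢x = contradiction refl y≢x

μ-letter : Letter → Letter → Word
μ-letter a a = a ∷ []
μ-letter a b = a ∷ b ∷ []
μ-letter b a = b ∷ a ∷ []
μ-letter b b = b ∷ []

μ : Letter → Word → Word
μ x = concatMap (μ-letter x)

μ-++ : ∀ x v w → μ x (v ++ w) ≡ μ x v ++ μ x w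
μ-++ x = concatMap-++ (μ-letter x)

μ-letter-self : ∀ x → μ-letter x x ≡ x ∷ []
μ-letter-self a = refl
μ-letter-self b = refl

μ-letter-≢ : ∀ {x y} → y ≢ x → μ-letter x y ≡ x ∷ y ∷ []
μ-letter-≢ {a} {a} y≢x = contradiction refl y≢x
μ-letter-≢ {a} {b} _   = refl
μ-letter-≢ {b} {a} _   = refl
μ-letter-≢ {b} {b} y≢x = contradiction refl y≢x

justin-∷ʳ-fresh : ∀ x u y → y ∉ x ∷ u → ψ (x ∷ u) ≡ μ x (ψ u) ∷ʳ x →
                  ψ (x ∷ u ∷ʳ y) ≡ μ x (ψ (u ∷ʳ y)) ∷ʳ x
justin-∷ʳ-fresh x u y y∉xu ih = begin
  ψ (x ∷ u ∷ʳ y)                         ≡⟨ ψ-∷ʳ-fresh (x ∷ u) y y∉xu ⟩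
  ψ (x ∷ u) ++ y ∷ ψ (x ∷ u)             ≡⟨ cong (λ v → v ++ y ∷ v) ih ⟩
  (M ∷ʳ x) ++ y ∷ (M ∷ʳ x)               ≡⟨ ++-assoc M (x ∷ []) (y ∷ M ∷ʳ x) ⟩
  M ++ x ∷ y ∷ (M ∷ʳ x)                  ≡⟨ ++-assoc M (x ∷ y ∷ M) (x ∷ []) ⟨
  (M ++ x ∷ y ∷ M) ∷ʳ x
    ≡⟨ cong (λ v → (M ++ v ++ M) ∷ʳ x) (μ-letter-≢ (y∉xu ∘ here)) ⟨
  (M ++ μ x (y ∷ ψ u)) ∷ʳ x              ≡⟨ cong (_∷ʳ x) (μ-++ x (ψ u) (y ∷ ψ u)) ⟨
  μ x (ψ u ++ y ∷ ψ u) ∷ʳ x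
    ≡⟨ cong (λ v → μ x v ∷ʳ x) (ψ-∷ʳ-fresh u y (y∉xu ∘ there)) ⟨
  μ x (ψ (u ∷ʳ y)) ∷ʳ x                  ∎
  where
  open ≡-Reasoning
  M = μ x (ψ u)

justin-∷ʳ-first : ∀ x u → x ∉ u → ψ (x ∷ u) ≡ μ x (ψ u) ∷ʳ x →
                  ψ (x ∷ u ∷ʳ x) ≡ μ x (ψ (u ∷ʳ x)) ∷ʳ x
justin-∷ʳ-first x u x∉u ih with ψ-++-∷ [] x u
... | t , ψxu≡xt = begin
  ψ (x ∷ u ∷ʳ x)                         ≡⟨ ψ-∷ʳ-repeat [] x u x∉u ψxu≡xt ⟩
  ψ (x ∷ u) ++ x ∷ t                     ≡⟨ cong (ψ (x ∷ u) ++_) ψxu≡xt ⟨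
  ψ (x ∷ u) ++ ψ (x ∷ u)                 ≡⟨ cong (λ v → v ++ v) ih ⟩
  (M ∷ʳ x) ++ (M ∷ʳ x)                   ≡⟨ ++-assoc M (x ∷ []) (M ∷ʳ x) ⟩
  M ++ x ∷ (M ∷ʳ x)                      ≡⟨ ++-assoc M (x ∷ M) (x ∷ []) ⟨
  (M ++ x ∷ M) ∷ʳ x                      ≡⟨ cong (λ v → (M ++ v ++ M) ∷ʳ x) (μ-letter-self x) ⟨
  (M ++ μ x (x ∷ ψ u)) ∷ʳ x              ≡⟨ cong (_∷ʳ x) (μ-++ x (ψ u) (x ∷ ψ u)) ⟨
  μ x (ψ u ++ x ∷ ψ u) ∷ʳ x              ≡⟨ cong (λ v → μ x v ∷ʳ x) (ψ-∷ʳ-fresh u x x∉u) ⟨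
  μ x (ψ (u ∷ʳ x)) ∷ʳ x                  ∎
  where
  open ≡-Reasoning
  M = μ x (ψ u)

justin-∷ʳ-repeat : ∀ x u₁ y u₂ → y ∉ u₂ →
                   ψ (x ∷ u₁) ≡ μ x (ψ u₁) ∷ʳ x →
                   ψ (x ∷ u₁ ++ y ∷ u₂) ≡ μ x (ψ (u₁ ++ y ∷ u₂)) ∷ʳ x →
                   ψ (x ∷ (u₁ ++ y ∷ u₂) ∷ʳ y) ≡ μ x (ψ ((u₁ ++ y ∷ u₂) ∷ʳ y)) ∷ʳ x
justin-∷ʳ-repeat x u₁ y u₂ y∉u₂ ih₁ ih with ψ-++-∷ u₁ y u₂ | ψ-++-∷ (x ∷ u₁) y u₂
... | t , ψu≡ | t′ , ψxu≡ = begin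
  ψ (x ∷ u ∷ʳ y)                         ≡⟨ ψ-∷ʳ-repeat (x ∷ u₁) y u₂ y∉u₂ ψxu≡ ⟩
  ψ (x ∷ u) ++ y ∷ t′                    ≡⟨ cong (_++ y ∷ t′) ih ⟩
  (M ∷ʳ x) ++ y ∷ t′                     ≡⟨ ++-assoc M (x ∷ []) (y ∷ t′) ⟩
  M ++ x ∷ y ∷ t′                        ≡⟨ cong (M ++_) tails ⟨
  M ++ (μ x (y ∷ t) ∷ʳ x)                ≡⟨ ++-assoc M (μ x (y ∷ t)) (x ∷ []) ⟨
  (M ++ μ x (y ∷ t)) ∷ʳ x                ≡⟨ cong (_∷ʳ x) (μ-++ x (ψ u) (y ∷ t)) ⟨
  μ x (ψ u ++ y ∷ t) ∷ʳ x
    ≡⟨ cong (λ v → μ x v ∷ʳ x) (ψ-∷ʳ-repeat u₁ y u₂ y∉u₂ ψu≡) ⟨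
  μ x (ψ (u ∷ʳ y)) ∷ʳ x                  ∎
  where
  open ≡-Reasoning
  u = u₁ ++ y ∷ u₂
  M = μ x (ψ u)
  M₁ = μ x (ψ u₁)
  tails : μ x (y ∷ t) ∷ʳ x ≡ x ∷ y ∷ t′
  tails = ++-cancelˡ M₁ _ _ (begin
    M₁ ++ (μ x (y ∷ t) ∷ʳ x)             ≡⟨ ++-assoc M₁ (μ x (y ∷ t)) (x ∷ []) ⟨
    (M₁ ++ μ x (y ∷ t)) ∷ʳ x             ≡⟨ cong (_∷ʳ x) (μ-++ x (ψ u₁) (y ∷ t)) ⟨
    μ x (ψ u₁ ++ y ∷ t) ∷ʳ x             ≡⟨ cong (λ v → μ x v ∷ʳ x) ψu≡ ⟨
    M ∷ʳ x                               ≡⟨ ih ⟨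
    ψ (x ∷ u)                            ≡⟨ ψxu≡ ⟩
    ψ (x ∷ u₁) ++ y ∷ t′                 ≡⟨ cong (_++ y ∷ t′) ih₁ ⟩
    (M₁ ∷ʳ x) ++ y ∷ t′                  ≡⟨ ++-assoc M₁ (x ∷ []) (y ∷ t′) ⟩
    M₁ ++ x ∷ y ∷ t′                     ∎)

justin : ∀ x u → ψ (x ∷ u) ≡ μ x (ψ u) ∷ʳ x
justin x u = go u (<-wellFounded (length u))
  where
  go : ∀ u → Acc _<_ (length u) → ψ (x ∷ u) ≡ μ x (ψ u) ∷ʳ x
  go u (acc rec) with reverseView u
  ... | [] = ψ-∷ʳ-fresh [] x λ ()
  ... | u′ ∶ _ ∶ʳ y with lastOccurrence y u′
  ...   | last u₁ {u₂} y∉u₂ =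
    justin-∷ʳ-repeat x u₁ y u₂ y∉u₂ (go u₁ (rec (<-trans (length-<-++-∷ u₁ y u₂) |u′|<)))
                                    (go u′ (rec |u′|<))
    where |u′|< = length-<-++-∷ u′ y []
  ...   | absent y∉u′ with y ≟L x
  ...     | yes refl = justin-∷ʳ-first x u′ y∉u′ (go u′ (rec (length-<-++-∷ u′ y [])))
  ...     | no y≢x   =
    justin-∷ʳ-fresh x u′ y (λ { (here y≡x) → y≢x y≡x ; (there y∈u′) → y∉u′ y∈u′ })
                           (go u′ (rec (length-<-++-∷ u′ y [])))

-- Letter counts

count : Letter → Word → ℕ
count c = length ∘ filter (c ≟L_)

count-++ : ∀ c v w → count c (v ++ w) ≡ count c v + count c w
count-++ c v w = trans (cong length (filter-++ (c ≟L_) v w)) (length-++ (filter (c ≟L_) v))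

length-μ : ∀ x w → length (μ x w) ≡ length w + count (other x) w
length-μ x []      = refl
length-μ a (a ∷ w) = cong suc (length-μ a w)
length-μ a (b ∷ w) = trans (cong (suc ∘ suc) (length-μ a w)) (sym (+-suc (suc (length w)) _))
length-μ b (a ∷ w) = trans (cong (suc ∘ suc) (length-μ b w)) (sym (+-suc (suc (length w)) _))
length-μ b (b ∷ w) = cong suc (length-μ b w)

count-other-μ : ∀ x w → count (other x) (μ x w) ≡ count (other x) w
count-other-μ x []      = refl
count-other-μ a (a ∷ w) = count-other-μ a w
count-other-μ a (b ∷ w) = cong suc (count-other-μ a w)
count-other-μ b (a ∷ w) = cong suc (count-other-μ b w)
count-other-μ b (b ∷ w) = count-other-μ b w

count-μ : ∀ x w → count x (μ x w) ≡ length w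
count-μ x []      = refl
count-μ a (a ∷ w) = cong suc (count-μ a w)
count-μ a (b ∷ w) = cong suc (count-μ a w)
count-μ b (a ∷ w) = cong suc (count-μ b w)
count-μ b (b ∷ w) = cong suc (count-μ b w)

count-other-singleton : ∀ x → count (other x) (x ∷ []) ≡ 0
count-other-singleton a = refl
count-other-singleton b = refl

count-singleton : ∀ x → count x (x ∷ []) ≡ 1
count-singleton a = refl
count-singleton b = refl

length-ψ-∷ : ∀ x u → length (ψ (x ∷ u)) ≡ suc (length (ψ u) + count (other x) (ψ u))
length-ψ-∷ x u = begin
  length (ψ (x ∷ u))                     ≡⟨ cong length (justin x u) ⟩
  length (μ x (ψ u) ∷ʳ x)                ≡⟨ length-++ (μ x (ψ u)) ⟩
  length (μ x (ψ u)) + 1                 ≡⟨ +-comm _ 1 ⟩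
  suc (length (μ x (ψ u)))               ≡⟨ cong suc (length-μ x (ψ u)) ⟩
  suc (length (ψ u) + count (other x) (ψ u)) ∎
  where open ≡-Reasoning

count-other-ψ-∷ : ∀ x u → count (other x) (ψ (x ∷ u)) ≡ count (other x) (ψ u)
count-other-ψ-∷ x u = begin
  count (other x) (ψ (x ∷ u))                                 ≡⟨ cong (count (other x)) (justin x u) ⟩
  count (other x) (μ x (ψ u) ∷ʳ x)                            ≡⟨ count-++ (other x) (μ x (ψ u)) (x ∷ []) ⟩
  count (other x) (μ x (ψ u)) + count (other x) (x ∷ [])
    ≡⟨ cong₂ _+_ (count-other-μ x (ψ u)) (count-other-singleton x) ⟩
  count (other x) (ψ u) + 0                                   ≡⟨ +-identityʳ _ ⟩
  count (other x) (ψ u)                                       ∎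
  where open ≡-Reasoning

count-ψ-∷ : ∀ x u → count x (ψ (x ∷ u)) ≡ suc (length (ψ u))
count-ψ-∷ x u = begin
  count x (ψ (x ∷ u))                         ≡⟨ cong (count x) (justin x u) ⟩
  count x (μ x (ψ u) ∷ʳ x)                    ≡⟨ count-++ x (μ x (ψ u)) (x ∷ []) ⟩
  count x (μ x (ψ u)) + count x (x ∷ [])      ≡⟨ cong₂ _+_ (count-μ x (ψ u)) (count-singleton x) ⟩
  length (ψ u) + 1                            ≡⟨ +-comm _ 1 ⟩
  suc (length (ψ u))                          ∎
  where open ≡-Reasoning

count-other-ψ-replicate : ∀ x k u → count (other x) (ψ (replicate k x ++ u)) ≡ count (other x) (ψ u)
count-other-ψ-replicate x zero    u = refl
count-other-ψ-replicate x (suc k) u =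
  trans (count-other-ψ-∷ x (replicate k x ++ u)) (count-other-ψ-replicate x k u)

length-ψ-replicate : ∀ x k u →
                     length (ψ (replicate k x ++ u)) ≡ length (ψ u) + k * suc (count (other x) (ψ u))
length-ψ-replicate x zero    u = sym (+-identityʳ _)
length-ψ-replicate x (suc k) u = begin
  length (ψ (x ∷ replicate k x ++ u))          ≡⟨ length-ψ-∷ x (replicate k x ++ u) ⟩
  suc (length (ψ (replicate k x ++ u)) + count (other x) (ψ (replicate k x ++ u)))
    ≡⟨ cong₂ (λ l c → suc (l + c)) (length-ψ-replicate x k u) (count-other-ψ-replicate x k u) ⟩
  suc (length (ψ u) + k * suc c + c)          ≡⟨ regroup (length (ψ u)) k c ⟩
  length (ψ u) + suc k * suc c                ∎
  where
  open ≡-Reasoning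
  c = count (other x) (ψ u)
  regroup : ∀ l k c → suc (l + k * suc c + c) ≡ l + suc k * suc c
  regroup = solve-∀

-- Blocks

‖aψ_b‖ : Word → ℕ
‖aψ v b‖ = length (a ∷ ψ v ++ b ∷ [])

‖aψb‖≡|ψ|+2 : ∀ v → ‖aψ v b‖ ≡ length (ψ v) + 2
‖aψb‖≡|ψ|+2 v = trans (cong suc (length-++ (ψ v))) (sym (+-suc (length (ψ v)) 1))

‖aψb‖-replicate : ∀ x k → ‖aψ replicate k x ++ [] b‖ ≡ k + 2
‖aψb‖-replicate x k = begin
  ‖aψ replicate k x ++ [] b‖                 ≡⟨ ‖aψb‖≡|ψ|+2 (replicate k x ++ []) ⟩
  length (ψ (replicate k x ++ [])) + 2       ≡⟨ cong (_+ 2) (length-ψ-replicate x k []) ⟩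
  k * 1 + 2                                  ≡⟨ cong (_+ 2) (*-identityʳ k) ⟩
  k + 2                                      ∎
  where open ≡-Reasoning

‖aψb‖-replicate-other : ∀ x k w →
                        ‖aψ replicate k x ++ other x ∷ w b‖ ≡ k * ‖aψ w b‖ + ‖aψ other x ∷ w b‖
‖aψb‖-replicate-other x k w = begin
  ‖aψ replicate k x ++ other x ∷ w b‖          ≡⟨ ‖aψb‖≡|ψ|+2 (replicate k x ++ other x ∷ w) ⟩
  length (ψ (replicate k x ++ other x ∷ w)) + 2
    ≡⟨ cong (_+ 2) (length-ψ-replicate x k (other x ∷ w)) ⟩
  length (ψ (other x ∷ w)) + k * suc (count (other x) (ψ (other x ∷ w))) + 2
    ≡⟨ cong (λ c → length (ψ (other x ∷ w)) + k * suc c + 2) (count-ψ-∷ (other x) w) ⟩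
  length (ψ (other x ∷ w)) + k * suc (suc (length (ψ w))) + 2
    ≡⟨ regroup (length (ψ (other x ∷ w))) k (length (ψ w)) ⟩
  k * (length (ψ w) + 2) + (length (ψ (other x ∷ w)) + 2)
    ≡⟨ cong₂ (λ m n → k * m + n) (‖aψb‖≡|ψ|+2 w) (‖aψb‖≡|ψ|+2 (other x ∷ w)) ⟨
  k * ‖aψ w b‖ + ‖aψ other x ∷ w b‖           ∎
  where
  open ≡-Reasoning
  regroup : ∀ l k m → l + k * suc (suc m) + 2 ≡ k * (m + 2) + (l + 2)
  regroup = solve-∀

telescope : ∀ n (f g : ℕ → ℕ) → (∀ j → j < n → f j ≡ g j + f (suc j)) →
            f 0 ≡ sum (applyUpTo g n) + f n
telescope zero    f g step = refl
telescope (suc n) f g step = begin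
  f 0                                            ≡⟨ step 0 z<s ⟩
  g 0 + f 1
    ≡⟨ cong (g 0 +_) (telescope n (f ∘ suc) (g ∘ suc) (λ j → step (suc j) ∘ s<s)) ⟩
  g 0 + (sum (applyUpTo (g ∘ suc) n) + f (suc n)) ≡⟨ +-assoc (g 0) _ _ ⟨
  sum (applyUpTo g (suc n)) + f (suc n)          ∎
  where open ≡-Reasoning

drop-applyUpTo : ∀ {A : Set} (f : ℕ → A) {m} j → j < m →
                 drop j (applyUpTo f m) ≡ f j ∷ drop (suc j) (applyUpTo f m)
drop-applyUpTo f {suc m} zero    _         = refl
drop-applyUpTo f {suc m} (suc j) (s≤s j<m) = drop-applyUpTo (f ∘ suc) j j<m

module _ (x : ℕ → Letter) (α : ℕ → ℕ) (n : ℕ) where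

  blocksFrom-unfold : ∀ j → j ≤ n → blocksFrom x α n j ≡ replicate (α j) (x j) ++ blocksFrom x α n (suc j)
  blocksFrom-unfold j j≤n = cong (concatMap (λ k → replicate (α k) (x k))) (drop-applyUpTo id j (s≤s j≤n))

  blocksFrom-end : blocksFrom x α n (suc n) ≡ []
  blocksFrom-end = cong (concatMap (λ k → replicate (α k) (x k)))
                      (drop-all (suc n) (upTo (suc n)) (≤-reflexive (length-applyUpTo id (suc n))))

  blocksFrom-tail : ℕ → Word
  blocksFrom-tail j = replicate (α j ∸ 1) (x j) ++ blocksFrom x α n (suc j)

  blocksFrom-∷ : ∀ j → j ≤ n → 1 ≤ α j → blocksFrom x α n j ≡ x j ∷ blocksFrom-tail j
  blocksFrom-∷ j j≤n 1≤αj with α j | 1≤αj | blocksFrom-unfold j j≤n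
  ... | suc _ | _ | eq = eq

  ‖aψb‖-blocksFrom-step : ∀ j → j < n → 1 ≤ α (suc j) → x (suc j) ≢ x j →
                          ‖aψ blocksFrom x α n j b‖
                          ≡ α j * ‖aψ blocksFrom-tail (suc j) b‖ + ‖aψ blocksFrom x α n (suc j) b‖
  ‖aψb‖-blocksFrom-step j j<n 1≤α x≢ = begin
    ‖aψ blocksFrom x α n j b‖                         ≡⟨ cong ‖aψ_b‖ (blocksFrom-unfold j (<⇒≤ j<n)) ⟩
    ‖aψ replicate (α j) (x j) ++ B′ b‖                ≡⟨ cong (λ v → ‖aψ replicate (α j) (x j) ++ v b‖) next ⟩
    ‖aψ replicate (α j) (x j) ++ other (x j) ∷ W b‖   ≡⟨ ‖aψb‖-replicate-other (x j) (α j) W ⟩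
    α j * ‖aψ W b‖ + ‖aψ other (x j) ∷ W b‖          ≡⟨ cong (λ v → α j * ‖aψ W b‖ + ‖aψ v b‖) next ⟨
    α j * ‖aψ W b‖ + ‖aψ B′ b‖                       ∎
    where
    open ≡-Reasoning
    B′ = blocksFrom x α n (suc j)
    W = blocksFrom-tail (suc j)
    next : B′ ≡ other (x j) ∷ W
    next = trans (blocksFrom-∷ (suc j) j<n 1≤α) (cong (_∷ W) (≢⇒other x≢))

  ‖aψb‖-blocksFrom-last : ‖aψ blocksFrom x α n n b‖ ≡ α n + 2
  ‖aψb‖-blocksFrom-last = begin
    ‖aψ blocksFrom x α n n b‖              ≡⟨ cong ‖aψ_b‖ (blocksFrom-unfold n ≤-refl) ⟩
    ‖aψ replicate (α n) (x n) ++ blocksFrom x α n (suc n) b‖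
      ≡⟨ cong (λ v → ‖aψ replicate (α n) (x n) ++ v b‖) blocksFrom-end ⟩
    ‖aψ replicate (α n) (x n) ++ [] b‖     ≡⟨ ‖aψb‖-replicate (x n) (α n) ⟩
    α n + 2                                ∎
    where open ≡-Reasoning

mainTheorem8 : (n : ℕ) (x : ℕ → Letter) (α : ℕ → ℕ)
    → (∀ i → i ≤ n → 1 ≤ α i)
    → (∀ i → i < n → x (suc i) ≢ x i)
    → length (a ∷ ψ (blocksFrom x α n 0) ++ b ∷ [])
      ≡ sum (map (λ i → α i * length (a ∷ ψ (replicate (α (suc i) ∸ 1) (x (suc i)) ++ blocksFrom x α n (suc (suc i))) ++ b ∷ [])) (upTo n))
        + α n + 2
mainTheorem8 n x α α≥1 alternating = begin
  ‖aψ blocksFrom x α n 0 b‖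
    ≡⟨ telescope n (λ j → ‖aψ blocksFrom x α n j b‖) G step ⟩
  sum (applyUpTo G n) + ‖aψ blocksFrom x α n n b‖
    ≡⟨ cong₂ _+_ (sym (cong sum (map-upTo G n))) (‖aψb‖-blocksFrom-last x α n) ⟩
  sum (map G (upTo n)) + (α n + 2)
    ≡⟨ +-assoc _ (α n) 2 ⟨
  sum (map G (upTo n)) + α n + 2
    ∎
  where
  open ≡-Reasoning
  G : ℕ → ℕ
  G i = α i * ‖aψ blocksFrom-tail x α n (suc i) b‖
  step : ∀ j → j < n → ‖aψ blocksFrom x α n j b‖ ≡ G j + ‖aψ blocksFrom x α n (suc j) b‖
  step j j<n = ‖aψb‖-blocksFrom-step x α n j j<n (α≥1 (suc j) j<n) (alternating j j<n)
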